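{- Let $L=\{r,b_0,b_1\}$ and $\mathcal{M}_2=\{r,b_0,b_1\}^3\setminus\{b_0,b_1\}^3$. Let $f(2)$ be the least positive integer $N$ such that the complete graph $K_N$ admits an edge-coloring $c:E(K_N)\to L$ that is good with respect to $\mathcal{M}_2$. Then $f(2)\le \binom{14}{7}=3432$.
   Context: For a complete graph $K_N$ with vertex set $V$ and an edge-coloring $c:E(K_N)\to L$, for distinct $x,y,z\in V$ write $c(xyz)=(c(xy),c(yz),c(xz))$. For $\mathcal{M}\subseteq L^3$, the coloring $c$ is good with respect to $\mathcal{M}$ if: (1) for all distinct $x,y\in V$ and every $(c(xy),j,k)\in\mathcal{M}$ there exists $z\in V$ (distinct from $x,y$) with $c(xyz)=(c(xy),j,k)$; (2) for all distinct $x,y,z\in V$, $c(xyz)\in\mathcal{M}$; (3) for every $x\in V$ and every $\ell\in L$ there exists $y\in V$ with $c(xy)=\ell$. Thus $\mathcal{M}_2$ consists of all color triples from $\{r,b_0,b_1\}$ except those with no $r$ entry (no triangle whose three edges are all in $\{b_0,b_1\}$). -}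

module Defs where

open import Data.Nat using (ℕ)
open import Data.Fin using (Fin)
open import Data.Product using (Σ; _×_; _,_; ∃)
open import Data.Sum using (_⊎_)
open import Relation.Binary.PropositionalEquality using (_≡_; _≢_)

data Colour : Set where
  r b₀ b₁ : Colour

Triple : Set
Triple = Colour × Colour × Colour

-- An edge-colouring of K_N on vertex set Fin N: a symmetric function
-- (values on the diagonal are irrelevant and never used).
Symmetric : {N : ℕ} → (Fin N → Fin N → Colour) → Set
Symmetric {N} c = (x y : Fin N) → c x y ≡ c y x

tri : {N : ℕ} → (Fin N → Fin N → Colour) → Fin N → Fin N → Fin N → Triple
tri c x y z = c x y , c y z , c x z

Good : {N : ℕ} → (Triple → Set) → (Fin N → Fin N → Colour) → Set
Good {N} M c =
  ((x y : Fin N) → x ≢ y → (j k : Colour) → M (c x y , j , k) →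
     Σ (Fin N) λ z → z ≢ x × z ≢ y × tri c x y z ≡ (c x y , j , k))
  ×
  ((x y z : Fin N) → x ≢ y → y ≢ z → x ≢ z → M (tri c x y z))
  ×
  ((x : Fin N) → (ℓ : Colour) → Σ (Fin N) λ y → y ≢ x × c x y ≡ ℓ)

M₂ : Triple → Set
M₂ (a , b , d) = a ≡ r ⊎ b ≡ r ⊎ d ≡ r

Admits : (Triple → Set) → ℕ → Set
Admits M N = Σ (Fin N → Fin N → Colour) λ c → Symmetric c × Good M c

-- The colouring is a Cayley colouring of the group 𝔽₂¹⁰ on 1024 ≤ 3432 vertices: the edge xy
-- gets the colour of x + y under a fixed map col : 𝔽₂¹⁰ → L. Translation invariance reduces
-- goodness of the whole colouring to finitely many conditions on col alone (a triangle x, y, z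
-- corresponds to the pair a = x + y, b = y + z, and an extension of the edge xy to a vector w,
-- taking z = y + w); for the explicit table of col below these conditions
-- are verified by exhaustive evaluation.

module Submission where

open import Data.Bool using (Bool; false; true; _xor_; _∧_; _∨_; T)
open import Data.Bool.Properties
  using (xor-comm; xor-assoc; xor-identityˡ; xor-identityʳ; xor-same; T-∧; T-∨)
  renaming (_≟_ to _≟ᵇ_)
open import Data.Fin using (Fin; zero; combine; remQuot)
open import Data.Fin.Properties using (2↔Bool; remQuot-combine; combine-remQuot)
open import Data.Nat using (ℕ; zero; suc; _≤_; _^_; s≤s; z≤n)
open import Data.Nat.Combinatorics using (_C_)
open import Data.Nat.Properties using (≤ᵇ⇒≤)
open import Data.Product using (Σ; ∃; _×_; _,_; proj₁; proj₂; uncurry)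
open import Data.Sum using (inj₁; inj₂)
open import Data.Unit using (tt)
open import Data.Vec using (Vec; []; _∷_; zipWith; replicate)
open import Data.Vec.Properties
  using (zipWith-comm; zipWith-assoc; zipWith-identityˡ; zipWith-identityʳ; ≡-dec)
open import Function using (_↔_; Inverse; Equivalence; mk↔ₛ′; _∘_)
open import Function.Properties.Inverse using (↔-sym)
open import Relation.Binary.Definitions using (DecidableEquality)
open import Relation.Binary.PropositionalEquality
open import Relation.Nullary using (Dec; yes; no)
open import Relation.Nullary.Decidable using (map′; _×-dec_; _⊎-dec_; _→-dec_; ¬?; T?; ⌊_⌋; toWitness)
open import Relation.Unary using (Decidable)
open import Defs

_≟ᶜ_ : DecidableEquality Colour
r ≟ᶜ r = yes refl
b₀ ≟ᶜ b₀ = yes refl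
b₁ ≟ᶜ b₁ = yes refl
r ≟ᶜ b₀ = no λ ()
r ≟ᶜ b₁ = no λ ()
b₀ ≟ᶜ r = no λ ()
b₀ ≟ᶜ b₁ = no λ ()
b₁ ≟ᶜ r = no λ ()
b₁ ≟ᶜ b₀ = no λ ()

∀-colour? : {P : Colour → Set} → Decidable P → Dec (∀ c → P c)
∀-colour? P? = map′ (λ { (pr , p₀ , p₁) r → pr ; (pr , p₀ , p₁) b₀ → p₀ ; (pr , p₀ , p₁) b₁ → p₁ })
                    (λ p → p r , p b₀ , p b₁)
                    (P? r ×-dec P? b₀ ×-dec P? b₁)

M₂? : Decidable M₂
M₂? (a , b , d) = a ≟ᶜ r ⊎-dec b ≟ᶜ r ⊎-dec d ≟ᶜ r

Vec↔Fin^ : ∀ {a} {A : Set a} {m} k → A ↔ Fin m → Vec A k ↔ Fin (m ^ k)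
Vec↔Fin^ {A = A} {m} k A↔Fin = mk↔ₛ′ (encode k) (decode k) (encode-decode k) (decode-encode k)
  where
  open Inverse A↔Fin using (to; from; strictlyInverseˡ; strictlyInverseʳ)

  encode : ∀ k → Vec A k → Fin (m ^ k)
  encode zero [] = zero
  encode (suc k) (a ∷ v) = combine (to a) (encode k v)

  decode : ∀ k → Fin (m ^ k) → Vec A k
  decode zero _ = []
  decode (suc k) = uncurry (λ q j → from q ∷ decode k j) ∘ remQuot (m ^ k)

  encode-decode : ∀ k i → encode k (decode k i) ≡ i
  encode-decode zero zero = refl
  encode-decode (suc k) i = begin
    combine (to (from q)) (encode k (decode k j)) ≡⟨ cong₂ combine (strictlyInverseˡ q) (encode-decode k j) ⟩
    combine q j                                   ≡⟨ combine-remQuot {m} (m ^ k) i ⟩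
    i                                             ∎
    where
    open ≡-Reasoning
    q : Fin m
    q = proj₁ (remQuot (m ^ k) i)
    j : Fin (m ^ k)
    j = proj₂ (remQuot {m} (m ^ k) i)

  decode-encode : ∀ k v → decode k (encode k v) ≡ v
  decode-encode zero [] = refl
  decode-encode (suc k) (a ∷ v) = begin
    decode (suc k) (combine (to a) (encode k v))
      ≡⟨ cong (uncurry λ q j → from q ∷ decode k j) (remQuot-combine (to a) (encode k v)) ⟩
    from (to a) ∷ decode k (encode k v)
      ≡⟨ cong₂ _∷_ (strictlyInverseʳ a) (decode-encode k v) ⟩
    a ∷ v
      ∎
    where open ≡-Reasoning

Bits : ℕ → Set
Bits = Vec Bool

infixl 6 _⊕_
_⊕_ : ∀ {k} → Bits k → Bits k → Bits k
_⊕_ = zipWith _xor_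

0ᵇ : ∀ {k} → Bits k
0ᵇ = replicate _ false

⊕-self : ∀ {k} (u : Bits k) → u ⊕ u ≡ 0ᵇ
⊕-self [] = refl
⊕-self (a ∷ u) = cong₂ _∷_ (xor-same a) (⊕-self u)

module _ {k : ℕ} where

  ⊕-comm : (u v : Bits k) → u ⊕ v ≡ v ⊕ u
  ⊕-comm = zipWith-comm xor-comm

  ⊕-assoc : (u v w : Bits k) → u ⊕ v ⊕ w ≡ u ⊕ (v ⊕ w)
  ⊕-assoc = zipWith-assoc xor-assoc

  ⊕-identityˡ : (u : Bits k) → 0ᵇ ⊕ u ≡ u
  ⊕-identityˡ = zipWith-identityˡ xor-identityˡ

  ⊕-identityʳ : (u : Bits k) → u ⊕ 0ᵇ ≡ u
  ⊕-identityʳ = zipWith-identityʳ xor-identityʳ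

  ⊕-cancelˡ : (u w : Bits k) → u ⊕ (u ⊕ w) ≡ w
  ⊕-cancelˡ u w = begin
    u ⊕ (u ⊕ w) ≡⟨ ⊕-assoc u u w ⟨
    u ⊕ u ⊕ w   ≡⟨ cong (_⊕ w) (⊕-self u) ⟩
    0ᵇ ⊕ w      ≡⟨ ⊕-identityˡ w ⟩
    w           ∎
    where open ≡-Reasoning

  ⊕-solveʳ : {u v w : Bits k} → u ⊕ w ≡ v → w ≡ u ⊕ v
  ⊕-solveʳ {u} {w = w} refl = sym (⊕-cancelˡ u w)

  ⊕≡0⇒≡ : {u v : Bits k} → u ⊕ v ≡ 0ᵇ → u ≡ v
  ⊕≡0⇒≡ {u} eq = trans (sym (⊕-identityʳ u)) (sym (⊕-solveʳ eq))

  ⊕-telescope : (u v w : Bits k) → u ⊕ v ⊕ (v ⊕ w) ≡ u ⊕ w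
  ⊕-telescope u v w = trans (⊕-assoc u v (v ⊕ w)) (cong (u ⊕_) (⊕-cancelˡ v w))

all-bits : ∀ {k} {P : Bits k → Set} → Decidable P → Bool
all-bits {zero} P? = ⌊ P? [] ⌋
all-bits {suc k} P? = all-bits (P? ∘ (false ∷_)) ∧ all-bits (P? ∘ (true ∷_))

all-bits-sound : ∀ {k} {P : Bits k → Set} (P? : Decidable P) → T (all-bits P?) → ∀ v → P v
all-bits-sound {zero} P? t [] = toWitness t
all-bits-sound {suc k} P? t (false ∷ v) = all-bits-sound _ (proj₁ (Equivalence.to T-∧ t)) v
all-bits-sound {suc k} P? t (true ∷ v) = all-bits-sound _ (proj₂ (Equivalence.to T-∧ t)) v

any-bits : ∀ {k} {P : Bits k → Set} → Decidable P → Bool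
any-bits {zero} P? = ⌊ P? [] ⌋
any-bits {suc k} P? = any-bits (P? ∘ (false ∷_)) ∨ any-bits (P? ∘ (true ∷_))

any-bits-sound : ∀ {k} {P : Bits k → Set} (P? : Decidable P) → T (any-bits P?) → ∃ P
any-bits-sound {zero} P? t = [] , toWitness t
any-bits-sound {suc k} P? t with Equivalence.to T-∨ t
... | inj₁ t₀ = let v , p = any-bits-sound _ t₀ in false ∷ v , p
... | inj₂ t₁ = let v , p = any-bits-sound _ t₁ in true ∷ v , p

module Cayley {k : ℕ} (col : Bits k → Colour) where

  Extends : Bits k → Colour → Colour → Bits k → Set
  Extends a j l w = w ≢ 0ᵇ × w ≢ a × col w ≡ j × col (a ⊕ w) ≡ l

  Realises : Colour → Bits k → Set
  Realises ℓ w = w ≢ 0ᵇ × col w ≡ ℓ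

  -- triangle is also required for a = 0ᵇ, b = 0ᵇ and a = b (where no triangle exists), so
  -- col 0ᵇ, which no edge receives, must be chosen to make those triples admissible; in
  -- return the check needs no distinctness tests on its 2²ᵏ pairs.
  record Conditions (M : Triple → Set) : Set where
    field
      triangle  : ∀ a b → M (col a , col b , col (a ⊕ b))
      extension : ∀ a → a ≢ 0ᵇ → ∀ j l → M (col a , j , l) → ∃ (Extends a j l)
      palette   : ∀ ℓ → ∃ (Realises ℓ)

  module Check {M : Triple → Set} (M? : Decidable M) where

    _≟_ : DecidableEquality (Bits k)
    _≟_ = ≡-dec _≟ᵇ_

    extends? : ∀ a j l → Decidable (Extends a j l)
    extends? a j l w = ¬? (w ≟ 0ᵇ) ×-dec ¬? (w ≟ a) ×-dec col w ≟ᶜ j ×-dec col (a ⊕ w) ≟ᶜ l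

    realises? : ∀ ℓ → Decidable (Realises ℓ)
    realises? ℓ w = ¬? (w ≟ 0ᵇ) ×-dec col w ≟ᶜ ℓ

    triangle? : Decidable λ a → T (all-bits λ b → M? (col a , col b , col (a ⊕ b)))
    triangle? a = T? _

    extension? : Decidable λ a → a ≢ 0ᵇ → ∀ j l → M (col a , j , l) → T (any-bits (extends? a j l))
    extension? a = ¬? (a ≟ 0ᵇ) →-dec ∀-colour? λ j → ∀-colour? λ l → M? (col a , j , l) →-dec T? _

    palette? : Dec (∀ ℓ → T (any-bits (realises? ℓ)))
    palette? = ∀-colour? λ ℓ → T? _

    check : Bool
    check = all-bits triangle? ∧ all-bits extension? ∧ ⌊ palette? ⌋

    check-sound : T check → Conditions M
    check-sound t
      with t-tri , t-rest ← Equivalence.to T-∧ t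
      with t-ext , t-pal ← Equivalence.to T-∧ t-rest = record
      { triangle  = λ a → all-bits-sound _ (all-bits-sound triangle? t-tri a)
      ; extension = λ a a≢0 j l m → any-bits-sound _ (all-bits-sound extension? t-ext a a≢0 j l m)
      ; palette   = λ ℓ → any-bits-sound _ (toWitness {a? = palette?} t-pal ℓ)
      }

  Bits↔Fin : Bits k ↔ Fin (2 ^ k)
  Bits↔Fin = Vec↔Fin^ k (↔-sym 2↔Bool)

  open Inverse Bits↔Fin using () renaming (to to vertex; from to bits)

  colouring : Fin (2 ^ k) → Fin (2 ^ k) → Colour
  colouring x y = col (bits x ⊕ bits y)

  colouring-sym : Symmetric colouring
  colouring-sym x y = cong col (⊕-comm (bits x) (bits y))

  bits-injective : ∀ {x y} → bits x ≡ bits y → x ≡ y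
  bits-injective {x} {y} eq = begin
    x               ≡⟨ Inverse.strictlyInverseˡ Bits↔Fin x ⟨
    vertex (bits x) ≡⟨ cong vertex eq ⟩
    vertex (bits y) ≡⟨ Inverse.strictlyInverseˡ Bits↔Fin y ⟩
    y               ∎
    where open ≡-Reasoning

  distinct⇒⊕≢0 : ∀ {x y} → x ≢ y → bits x ⊕ bits y ≢ 0ᵇ
  distinct⇒⊕≢0 x≢y = x≢y ∘ bits-injective ∘ ⊕≡0⇒≡

  infixl 6 _+ᵛ_
  _+ᵛ_ : Fin (2 ^ k) → Bits k → Fin (2 ^ k)
  x +ᵛ w = vertex (bits x ⊕ w)

  bits-+ᵛ : ∀ x w → bits (x +ᵛ w) ≡ bits x ⊕ w
  bits-+ᵛ x w = Inverse.strictlyInverseʳ Bits↔Fin (bits x ⊕ w)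

  +ᵛ-solve : ∀ {x y} w → x +ᵛ w ≡ y → w ≡ bits x ⊕ bits y
  +ᵛ-solve {x} w eq = ⊕-solveʳ (trans (sym (bits-+ᵛ x w)) (cong bits eq))

  +ᵛ-≢ : ∀ x {w} → w ≢ 0ᵇ → x +ᵛ w ≢ x
  +ᵛ-≢ x {w} w≢0 eq = w≢0 (trans (+ᵛ-solve w eq) (⊕-self (bits x)))

  colouring-+ᵛ : ∀ x w → colouring x (x +ᵛ w) ≡ col w
  colouring-+ᵛ x w = cong col (trans (cong (bits x ⊕_) (bits-+ᵛ x w)) (⊕-cancelˡ (bits x) w))

  good : ∀ {M} → Conditions M → Good M colouring
  good {M} conds = extend , triangles , sees
    where
    open Conditions conds

    triangles : ∀ x y z → x ≢ y → y ≢ z → x ≢ z → M (tri colouring x y z)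
    triangles x y z _ _ _ =
      subst (λ v → M (colouring x y , colouring y z , col v)) (⊕-telescope (bits x) (bits y) (bits z))
        (triangle (bits x ⊕ bits y) (bits y ⊕ bits z))

    extend : ∀ x y → x ≢ y → ∀ j l → M (colouring x y , j , l) →
             Σ (Fin (2 ^ k)) λ z → z ≢ x × z ≢ y × tri colouring x y z ≡ (colouring x y , j , l)
    extend x y x≢y j l m
      with w , w≢0 , w≢a , cw , caw ← extension (bits x ⊕ bits y) (distinct⇒⊕≢0 x≢y) j l m =
      y +ᵛ w , z≢x , +ᵛ-≢ y w≢0 , cong₂ (λ j′ l′ → colouring x y , j′ , l′) (trans (colouring-+ᵛ y w) cw) cxz
      where
      z≢x : y +ᵛ w ≢ x
      z≢x eq = w≢a (trans (+ᵛ-solve w eq) (⊕-comm (bits y) (bits x)))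

      cxz : colouring x (y +ᵛ w) ≡ l
      cxz = begin
        col (bits x ⊕ bits (y +ᵛ w)) ≡⟨ cong (λ v → col (bits x ⊕ v)) (bits-+ᵛ y w) ⟩
        col (bits x ⊕ (bits y ⊕ w))  ≡⟨ cong col (⊕-assoc (bits x) (bits y) w) ⟨
        col (bits x ⊕ bits y ⊕ w)    ≡⟨ caw ⟩
        l                            ∎
        where open ≡-Reasoning

    sees : ∀ x ℓ → Σ (Fin (2 ^ k)) λ y → y ≢ x × colouring x y ≡ ℓ
    sees x ℓ with w , w≢0 , cw ← palette ℓ = x +ᵛ w , +ᵛ-≢ x w≢0 , trans (colouring-+ᵛ x w) cw

  admits : ∀ {M} → Conditions M → Admits M (2 ^ k)
  admits conds = colouring , colouring-sym , good conds

data BitTrie (A : Set) : ℕ → Set where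
  leaf : A → BitTrie A 0
  node : ∀ {k} → BitTrie A k → BitTrie A k → BitTrie A (suc k)

infix 7 _∣_
_∣_ : ∀ {A} → A → A → BitTrie A 1
a ∣ b = node (leaf a) (leaf b)

lookupᵗ : ∀ {A k} → BitTrie A k → Bits k → A
lookupᵗ (leaf a) [] = a
lookupᵗ (node t₀ t₁) (false ∷ v) = lookupᵗ t₀ v
lookupᵗ (node t₀ t₁) (true ∷ v) = lookupᵗ t₁ v

-- The leaf at position i holds the colour of the bit vector with binary expansion i (most
-- significant bit first); in particular 0ᵇ gets r.
table : BitTrie Colour 10
table =
  node
    (node
      (node
        (node
          (node
            (node
              (node (node (node (r ∣ b₁) (b₁ ∣ r)) (node (b₀ ∣ r) (r ∣ r))) (node (node (r ∣ r) (r ∣ r)) (node (r ∣ r) (b₁ ∣ r))))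
              (node (node (node (r ∣ r) (r ∣ r)) (node (b₀ ∣ r) (r ∣ b₀))) (node (node (r ∣ r) (r ∣ r)) (node (r ∣ r) (r ∣ r)))))
            (node
              (node (node (node (r ∣ r) (r ∣ r)) (node (r ∣ b₀) (r ∣ r))) (node (node (r ∣ b₀) (b₀ ∣ r)) (node (r ∣ r) (r ∣ r))))
              (node (node (node (r ∣ r) (r ∣ r)) (node (r ∣ r) (r ∣ r))) (node (node (r ∣ r) (b₀ ∣ r)) (node (r ∣ r) (r ∣ r))))))
          (node
            (node
              (node (node (node (r ∣ r) (r ∣ r)) (node (b₀ ∣ r) (r ∣ r))) (node (node (r ∣ b₁) (r ∣ r)) (node (r ∣ r) (r ∣ r))))
              (node (node (node (r ∣ b₁) (r ∣ r)) (node (r ∣ r) (b₁ ∣ r))) (node (node (r ∣ r) (r ∣ r)) (node (r ∣ r) (r ∣ r)))))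
            (node
              (node (node (node (r ∣ r) (b₀ ∣ r)) (node (r ∣ r) (r ∣ r))) (node (node (b₀ ∣ r) (r ∣ r)) (node (r ∣ r) (r ∣ r))))
              (node (node (node (r ∣ r) (r ∣ r)) (node (r ∣ r) (r ∣ r))) (node (node (r ∣ b₀) (b₀ ∣ r)) (node (r ∣ r) (r ∣ r)))))))
        (node
          (node
            (node
              (node (node (node (r ∣ r) (r ∣ r)) (node (r ∣ r) (r ∣ r))) (node (node (r ∣ b₁) (b₁ ∣ r)) (node (r ∣ r) (r ∣ r))))
              (node (node (node (r ∣ r) (r ∣ r)) (node (b₀ ∣ r) (r ∣ r))) (node (node (b₁ ∣ r) (r ∣ b₀)) (node (r ∣ r) (r ∣ r)))))
            (node
              (node (node (node (r ∣ r) (r ∣ r)) (node (r ∣ r) (r ∣ b₀))) (node (node (r ∣ r) (r ∣ r)) (node (r ∣ r) (r ∣ r))))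
              (node (node (node (r ∣ r) (r ∣ r)) (node (b₀ ∣ r) (r ∣ b₁))) (node (node (r ∣ r) (r ∣ r)) (node (r ∣ r) (r ∣ b₁))))))
          (node
            (node
              (node (node (node (r ∣ b₀) (r ∣ r)) (node (b₁ ∣ r) (r ∣ b₁))) (node (node (b₁ ∣ r) (r ∣ b₀)) (node (r ∣ r) (r ∣ r))))
              (node (node (node (r ∣ r) (r ∣ r)) (node (b₁ ∣ r) (r ∣ r))) (node (node (r ∣ b₁) (r ∣ r)) (node (r ∣ r) (r ∣ r)))))
            (node
              (node (node (node (b₀ ∣ r) (r ∣ r)) (node (r ∣ r) (r ∣ b₁))) (node (node (r ∣ r) (b₁ ∣ r)) (node (b₀ ∣ r) (r ∣ b₀))))
              (node (node (node (r ∣ r) (r ∣ r)) (node (r ∣ b₀) (r ∣ r))) (node (node (r ∣ r) (r ∣ r)) (node (r ∣ r) (r ∣ b₁))))))))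
      (node
        (node
          (node
            (node
              (node (node (node (r ∣ b₀) (r ∣ r)) (node (r ∣ r) (b₁ ∣ r))) (node (node (r ∣ r) (r ∣ r)) (node (r ∣ r) (r ∣ r))))
              (node (node (node (r ∣ r) (r ∣ r)) (node (b₁ ∣ r) (r ∣ r))) (node (node (r ∣ b₀) (r ∣ r)) (node (r ∣ r) (r ∣ r)))))
            (node
              (node (node (node (r ∣ r) (r ∣ r)) (node (r ∣ r) (r ∣ r))) (node (node (r ∣ b₀) (b₀ ∣ r)) (node (r ∣ r) (r ∣ r))))
              (node (node (node (r ∣ r) (b₀ ∣ r)) (node (r ∣ r) (r ∣ r))) (node (node (b₁ ∣ r) (r ∣ r)) (node (r ∣ r) (r ∣ r))))))
          (node
            (node
              (node (node (node (r ∣ r) (r ∣ r)) (node (r ∣ r) (b₁ ∣ r))) (node (node (r ∣ b₀) (b₁ ∣ r)) (node (b₀ ∣ r) (r ∣ r))))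
              (node (node (node (r ∣ r) (r ∣ r)) (node (r ∣ b₁) (b₀ ∣ r))) (node (node (r ∣ b₁) (r ∣ r)) (node (r ∣ r) (r ∣ r)))))
            (node
              (node (node (node (r ∣ b₀) (b₁ ∣ r)) (node (r ∣ r) (r ∣ b₀))) (node (node (b₁ ∣ r) (r ∣ b₁)) (node (r ∣ r) (r ∣ r))))
              (node (node (node (r ∣ r) (b₁ ∣ r)) (node (r ∣ r) (r ∣ r))) (node (node (r ∣ b₁) (b₀ ∣ r)) (node (r ∣ r) (r ∣ r)))))))
        (node
          (node
            (node
              (node (node (node (r ∣ r) (r ∣ b₁)) (node (r ∣ r) (r ∣ r))) (node (node (r ∣ b₀) (b₁ ∣ r)) (node (r ∣ r) (r ∣ r))))
              (node (node (node (r ∣ r) (r ∣ r)) (node (r ∣ r) (r ∣ r))) (node (node (r ∣ r) (r ∣ b₁)) (node (b₀ ∣ r) (r ∣ r)))))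
            (node
              (node (node (node (r ∣ r) (b₁ ∣ r)) (node (b₁ ∣ r) (r ∣ b₀))) (node (node (b₁ ∣ r) (r ∣ r)) (node (r ∣ r) (r ∣ r))))
              (node (node (node (r ∣ r) (r ∣ r)) (node (b₁ ∣ r) (r ∣ b₀))) (node (node (r ∣ r) (r ∣ r)) (node (r ∣ r) (r ∣ r))))))
          (node
            (node
              (node (node (node (r ∣ r) (r ∣ r)) (node (b₁ ∣ r) (r ∣ r))) (node (node (b₀ ∣ r) (r ∣ b₁)) (node (r ∣ r) (r ∣ r))))
              (node (node (node (r ∣ r) (r ∣ r)) (node (r ∣ r) (r ∣ r))) (node (node (r ∣ b₁) (b₀ ∣ r)) (node (r ∣ r) (r ∣ r)))))
            (node
              (node (node (node (r ∣ r) (r ∣ r)) (node (b₀ ∣ r) (r ∣ b₁))) (node (node (r ∣ r) (r ∣ r)) (node (r ∣ r) (r ∣ b₁))))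
              (node (node (node (r ∣ r) (r ∣ r)) (node (r ∣ r) (r ∣ b₀))) (node (node (r ∣ r) (r ∣ r)) (node (r ∣ r) (r ∣ r)))))))))
    (node
      (node
        (node
          (node
            (node
              (node (node (node (b₁ ∣ r) (r ∣ b₀)) (node (r ∣ r) (r ∣ r))) (node (node (r ∣ r) (r ∣ b₀)) (node (r ∣ r) (r ∣ r))))
              (node (node (node (r ∣ r) (r ∣ r)) (node (r ∣ r) (r ∣ r))) (node (node (b₁ ∣ r) (r ∣ b₁)) (node (r ∣ r) (r ∣ r)))))
            (node
              (node (node (node (r ∣ r) (r ∣ r)) (node (r ∣ r) (r ∣ b₁))) (node (node (b₀ ∣ r) (r ∣ b₁)) (node (r ∣ r) (r ∣ r))))
              (node (node (node (r ∣ r) (r ∣ r)) (node (r ∣ b₀) (r ∣ r))) (node (node (r ∣ r) (r ∣ r)) (node (r ∣ r) (r ∣ r))))))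
          (node
            (node
              (node (node (node (r ∣ r) (r ∣ r)) (node (r ∣ r) (b₀ ∣ r))) (node (node (r ∣ r) (r ∣ b₁)) (node (r ∣ r) (r ∣ r))))
              (node (node (node (b₀ ∣ r) (r ∣ b₀)) (node (r ∣ r) (r ∣ r))) (node (node (r ∣ b₁) (r ∣ r)) (node (r ∣ r) (r ∣ r)))))
            (node
              (node (node (node (r ∣ r) (r ∣ r)) (node (r ∣ r) (r ∣ b₀))) (node (node (r ∣ r) (r ∣ r)) (node (r ∣ b₁) (r ∣ r))))
              (node (node (node (r ∣ r) (r ∣ r)) (node (b₀ ∣ r) (r ∣ b₀))) (node (node (b₀ ∣ r) (r ∣ b₀)) (node (r ∣ r) (r ∣ r)))))))
        (node
          (node
            (node
              (node (node (node (r ∣ r) (r ∣ r)) (node (r ∣ b₀) (b₁ ∣ r))) (node (node (r ∣ r) (r ∣ r)) (node (r ∣ r) (r ∣ r))))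
              (node (node (node (r ∣ r) (r ∣ r)) (node (r ∣ b₀) (b₀ ∣ r))) (node (node (r ∣ b₀) (b₀ ∣ r)) (node (r ∣ r) (r ∣ r)))))
            (node
              (node (node (node (r ∣ r) (r ∣ r)) (node (r ∣ r) (r ∣ r))) (node (node (b₁ ∣ r) (r ∣ r)) (node (r ∣ r) (r ∣ r))))
              (node (node (node (r ∣ b₁) (b₀ ∣ r)) (node (r ∣ r) (r ∣ r))) (node (node (b₀ ∣ r) (r ∣ b₀)) (node (r ∣ b₁) (r ∣ r))))))
          (node
            (node
              (node (node (node (r ∣ r) (r ∣ r)) (node (r ∣ b₀) (b₁ ∣ r))) (node (node (r ∣ b₁) (r ∣ r)) (node (r ∣ r) (b₁ ∣ r))))
              (node (node (node (r ∣ r) (r ∣ r)) (node (r ∣ r) (b₀ ∣ r))) (node (node (r ∣ r) (r ∣ b₁)) (node (r ∣ r) (r ∣ r)))))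
            (node
              (node (node (node (r ∣ r) (b₀ ∣ r)) (node (r ∣ b₀) (r ∣ r))) (node (node (b₁ ∣ r) (r ∣ r)) (node (r ∣ r) (r ∣ r))))
              (node (node (node (b₁ ∣ r) (r ∣ r)) (node (r ∣ r) (r ∣ r))) (node (node (r ∣ r) (b₀ ∣ r)) (node (r ∣ r) (r ∣ r))))))))
      (node
        (node
          (node
            (node
              (node (node (node (r ∣ r) (r ∣ b₀)) (node (b₀ ∣ r) (r ∣ r))) (node (node (b₁ ∣ r) (r ∣ b₁)) (node (r ∣ r) (r ∣ r))))
              (node (node (node (r ∣ b₀) (r ∣ r)) (node (r ∣ r) (r ∣ r))) (node (node (b₁ ∣ r) (r ∣ b₀)) (node (r ∣ r) (r ∣ r)))))
            (node
              (node (node (node (r ∣ r) (r ∣ r)) (node (r ∣ b₀) (r ∣ r))) (node (node (b₀ ∣ r) (r ∣ r)) (node (r ∣ r) (r ∣ b₀))))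
              (node (node (node (b₁ ∣ r) (r ∣ r)) (node (r ∣ b₁) (b₀ ∣ r))) (node (node (r ∣ r) (b₁ ∣ r)) (node (r ∣ r) (r ∣ r))))))
          (node
            (node
              (node (node (node (r ∣ r) (r ∣ r)) (node (r ∣ r) (r ∣ r))) (node (node (b₁ ∣ r) (r ∣ b₀)) (node (r ∣ r) (r ∣ r))))
              (node (node (node (b₀ ∣ r) (r ∣ b₀)) (node (r ∣ r) (r ∣ r))) (node (node (r ∣ r) (r ∣ b₀)) (node (r ∣ r) (r ∣ r)))))
            (node
              (node (node (node (r ∣ r) (r ∣ r)) (node (r ∣ b₁) (r ∣ r))) (node (node (r ∣ r) (r ∣ r)) (node (r ∣ r) (r ∣ r))))
              (node (node (node (r ∣ r) (r ∣ r)) (node (r ∣ r) (r ∣ b₀))) (node (node (b₁ ∣ r) (r ∣ b₀)) (node (r ∣ r) (r ∣ r)))))))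
        (node
          (node
            (node
              (node (node (node (r ∣ r) (r ∣ r)) (node (r ∣ r) (b₀ ∣ r))) (node (node (r ∣ r) (r ∣ b₀)) (node (r ∣ r) (r ∣ r))))
              (node (node (node (r ∣ r) (r ∣ r)) (node (r ∣ b₀) (b₁ ∣ r))) (node (node (r ∣ b₀) (r ∣ r)) (node (r ∣ r) (b₀ ∣ r)))))
            (node
              (node (node (node (b₁ ∣ r) (r ∣ r)) (node (r ∣ r) (r ∣ r))) (node (node (r ∣ r) (b₀ ∣ r)) (node (r ∣ r) (r ∣ r))))
              (node (node (node (r ∣ r) (b₀ ∣ r)) (node (r ∣ b₀) (r ∣ r))) (node (node (b₀ ∣ r) (r ∣ r)) (node (r ∣ r) (r ∣ r))))))
          (node
            (node
              (node (node (node (r ∣ r) (r ∣ r)) (node (r ∣ r) (b₀ ∣ r))) (node (node (r ∣ r) (r ∣ r)) (node (r ∣ b₀) (b₁ ∣ r))))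
              (node (node (node (r ∣ r) (r ∣ r)) (node (b₀ ∣ r) (r ∣ r))) (node (node (b₀ ∣ r) (r ∣ b₀)) (node (r ∣ r) (b₁ ∣ r)))))
            (node
              (node (node (node (r ∣ r) (r ∣ r)) (node (r ∣ b₀) (b₁ ∣ r))) (node (node (r ∣ r) (b₁ ∣ r)) (node (r ∣ r) (r ∣ r))))
              (node (node (node (b₀ ∣ r) (r ∣ b₀)) (node (r ∣ b₀) (r ∣ r))) (node (node (r ∣ b₁) (b₀ ∣ r)) (node (r ∣ r) (r ∣ r)))))))))

theorem1 : Σ ℕ (λ N → 1 ≤ N × N ≤ 14 C 7 × Admits M₂ N)
-- The argument of check-sound, a proof of T check, is left for Agda to solve by η for ⊤; this
-- evaluates check several times faster than checking tt against T check.
theorem1 = 2 ^ 10 , s≤s z≤n , ≤ᵇ⇒≤ (2 ^ 10) (14 C 7) tt , admits (check-sound _)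
  where
  open Cayley (lookupᵗ table)
  open Check M₂?
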